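{- Let $h,w\ge 4$ and let $G=C_w(U)\sqcap C_h$ with $U=\{i\}$ for some vertex $i$ of $C_w$. Then $Z(G)\le h+2$.
   Context: All graphs are finite, simple and undirected. The cycle $C_n$ ($n\ge3$) has vertex set $\{1,\dots,n\}$ and edges $\{k,k+1\}$ for $1\le k\le n-1$ together with $\{n,1\}$. For graphs $W,H$ and a subset $U\subseteq V(W)$ (the root set), the (generalized) hierarchical product $W(U)\sqcap H$ is the graph with vertex set $V(W)\times V(H)$ in which $(x_1,y_1)$ and $(x_2,y_2)$ are adjacent if and only if either ($x_1=x_2\in U$ and $y_1y_2\in E(H)$) or ($y_1=y_2$ and $x_1x_2\in E(W)$). Zero forcing: starting from a set $S$ of filled vertices, repeatedly apply the color change rule: if a filled vertex has exactly one unfilled neighbor, that neighbor becomes filled. $S$ is a zero forcing set if this eventually fills every vertex. The zero forcing number $Z(G)$ is the minimum size of a zero forcing set of $G$. -}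

module Defs where

open import Level using (0ℓ)
open import Data.Nat using (ℕ; suc)
open import Data.Fin using (Fin; toℕ)
open import Data.Product using (_×_; _,_)
open import Data.Sum using (_⊎_)
open import Data.List using (List)
open import Data.List.Membership.Propositional using (_∈_)
open import Relation.Binary.PropositionalEquality using (_≡_)
open import Relation.Nullary using (¬_)

Graph : Set → Set₁
Graph V = V → V → Set

-- The cycle C_n on vertex set Fin n (vertex k of the paper is Fin index k-1):
-- edges {k, k+1} for consecutive indices and the edge {n-1, 0} (i.e. {n,1}).
Cycle : (n : ℕ) → Graph (Fin n)
Cycle n a b =
  (suc (toℕ a) ≡ toℕ b) ⊎ (suc (toℕ b) ≡ toℕ a)
  ⊎ ((toℕ a ≡ 0 × suc (toℕ b) ≡ n) ⊎ (toℕ b ≡ 0 × suc (toℕ a) ≡ n))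

HierProd : {A B : Set} → Graph A → (A → Set) → Graph B → Graph (A × B)
HierProd W U H (x₁ , y₁) (x₂ , y₂) =
  (x₁ ≡ x₂ × U x₁ × H y₁ y₂) ⊎ (y₁ ≡ y₂ × W x₁ x₂)

-- Vertices filled by the zero forcing process started from S
-- (closure under the colour change rule: a filled vertex u all of whose
-- neighbours other than v are filled forces its neighbour v).
data Filled {V : Set} (G : Graph V) (S : List V) : V → Set where
  initial : ∀ {v} → v ∈ S → Filled G S v
  force   : ∀ {u v} → Filled G S u → G u v →
            (∀ x → G u x → ¬ (x ≡ v) → Filled G S x) → Filled G S v

IsZeroForcingSet : {V : Set} → Graph V → List V → Set
IsZeroForcingSet G S = ∀ v → Filled G S v

-- In a row y of the product whose vertex (i , y) is filled, the row is a copy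
-- of C_w in which only (i , y) has neighbours outside the row; so if (i + 1 , y)
-- is filled as well, forcing runs round the cycle from i + 1 and fills the row.
-- Start from all of column i + 1 together with (i , 0) and (i , 1): rows 0 and 1
-- fill, and whenever rows y - 1 and y are full, (i , y) forces (i , y + 1),
-- which fills row y + 1.  Thus these h + 2 vertices force the whole graph.
module Submission where

open import Defs
open import Data.Nat using (ℕ; zero; suc; _≤_; _<_; _+_; _∸_; z≤n; s≤s; _<?_; _≤?_)
open import Data.Nat.Properties
open import Data.Fin using (Fin; toℕ; fromℕ<) renaming (zero to fzero)
open import Data.Fin.Properties using (toℕ-fromℕ<; toℕ-injective; toℕ<n)
open import Data.Product using (Σ; _×_; _,_)
open import Data.Sum using (_⊎_; inj₁; inj₂)
open import Data.Empty using (⊥-elim)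
open import Data.List using (List; length; map; _∷_; allFin)
open import Data.List.Properties using (length-map; length-tabulate)
open import Data.List.Relation.Unary.Any using (here; there)
open import Data.List.Membership.Propositional.Properties using (∈-map⁺; ∈-allFin)
open import Function using (_∘_; id)
open import Relation.Nullary using (¬_; yes; no)
open import Relation.Binary.PropositionalEquality

ForcingClosedExcept : {V : Set} → Graph V → V → (V → Set) → Set
ForcingClosedExcept G r P =
  ∀ {a c} → ¬ a ≡ r → G a c → (∀ x → G a x → ¬ x ≡ c → P x) → P a → P c

Follows : (n : ℕ) → Fin n → Fin n → Set
Follows n a b = suc (toℕ a) ≡ toℕ b ⊎ (toℕ b ≡ 0 × suc (toℕ a) ≡ n)

module _ {n : ℕ} where

  Cycle-follows : {a b : Fin n} → Follows n a b → Cycle n a b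
  Cycle-follows (inj₁ e) = inj₁ e
  Cycle-follows (inj₂ e) = inj₂ (inj₂ (inj₂ e))

  Cycle⇒follows : {a b : Fin n} → Cycle n a b → Follows n a b ⊎ Follows n b a
  Cycle⇒follows (inj₁ e)                = inj₁ (inj₁ e)
  Cycle⇒follows (inj₂ (inj₁ e))         = inj₂ (inj₁ e)
  Cycle⇒follows (inj₂ (inj₂ (inj₁ e))) = inj₂ (inj₂ e)
  Cycle⇒follows (inj₂ (inj₂ (inj₂ e))) = inj₁ (inj₂ e)

  follows-functional : {a b c : Fin n} → Follows n a b → Follows n a c → b ≡ c
  follows-functional (inj₁ e)        (inj₁ e′)        = toℕ-injective (trans (sym e) e′)
  follows-functional (inj₁ e)        (inj₂ (_ , e′))  = ⊥-elim (<-irrefl (trans (sym e) e′) (toℕ<n _))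
  follows-functional (inj₂ (_ , e))  (inj₁ e′)        = ⊥-elim (<-irrefl (trans (sym e′) e) (toℕ<n _))
  follows-functional (inj₂ (b0 , _)) (inj₂ (c0 , _))  = toℕ-injective (trans b0 (sym c0))

  follows-injective : {a b c : Fin n} → Follows n a c → Follows n b c → a ≡ b
  follows-injective (inj₁ e)        (inj₁ e′)       = toℕ-injective (suc-injective (trans e (sym e′)))
  follows-injective (inj₁ e)        (inj₂ (c0 , _)) = ⊥-elim (1+n≢0 (trans e c0))
  follows-injective (inj₂ (c0 , _)) (inj₁ e′)       = ⊥-elim (1+n≢0 (trans e′ c0))
  follows-injective (inj₂ (_ , e))  (inj₂ (_ , e′)) = toℕ-injective (suc-injective (trans e (sym e′)))

next : {n : ℕ} → Fin (suc n) → Fin (suc n)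
next {n} a with suc (toℕ a) <? suc n
... | yes a+1<n = fromℕ< a+1<n
... | no _      = fzero

follows-next : {n : ℕ} (a : Fin (suc n)) → Follows (suc n) a (next a)
follows-next {n} a with suc (toℕ a) <? suc n
... | yes a+1<n = inj₁ (sym (toℕ-fromℕ< a+1<n))
... | no a+1≮n  = inj₂ (refl , ≤-antisym (toℕ<n a) (≮⇒≥ a+1≮n))

module Orbit {n : ℕ} (r : Fin (suc n)) where

  orbit : ℕ → Fin (suc n)
  orbit zero    = r
  orbit (suc k) = next (orbit k)

  toℕ-orbit : ∀ k → k ≤ suc n →
              toℕ (orbit k) ≡ toℕ r + k ⊎ toℕ (orbit k) + suc n ≡ toℕ r + k
  toℕ-orbit zero    _     = inj₁ (sym (+-identityʳ (toℕ r)))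
  toℕ-orbit (suc k) k<1+n with toℕ-orbit k (<⇒≤ k<1+n) | follows-next (orbit k)
  ... | inj₁ t | inj₁ s       = inj₁ (trans (sym s) (trans (cong suc t) (sym (+-suc (toℕ r) k))))
  ... | inj₁ t | inj₂ (z , s) = inj₂ (begin
        toℕ (orbit (suc k)) + suc n ≡⟨ cong (_+ suc n) z ⟩
        suc n                       ≡⟨ sym s ⟩
        suc (toℕ (orbit k))         ≡⟨ cong suc t ⟩
        suc (toℕ r + k)             ≡⟨ sym (+-suc (toℕ r) k) ⟩
        toℕ r + suc k               ∎)
    where open ≡-Reasoning
  ... | inj₂ t | inj₁ s       = inj₂ (trans (cong (_+ suc n) (sym s)) (trans (cong suc t) (sym (+-suc (toℕ r) k))))
  ... | inj₂ t | inj₂ (_ , s) = ⊥-elim (1+n≰n (begin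
        suc (n + n)           ≡⟨ sym (+-suc n n) ⟩
        n + suc n             ≡⟨ cong (_+ suc n) (suc-injective (sym s)) ⟩
        toℕ (orbit k) + suc n ≡⟨ t ⟩
        toℕ r + k             ≤⟨ +-mono-≤ (≤-pred (toℕ<n r)) (≤-pred k<1+n) ⟩
        n + n                 ∎))
    where open ≤-Reasoning

  orbit-avoids-root : ∀ k → 0 < k → k ≤ n → ¬ orbit k ≡ r
  orbit-avoids-root k 0<k k≤n orbit≡r with toℕ-orbit k (m≤n⇒m≤1+n k≤n)
  ... | inj₁ t = <-irrefl (trans (sym (cong toℕ orbit≡r)) t) (m<m+n (toℕ r) 0<k)
  ... | inj₂ t = 1+n≰n (subst (_≤ n) (sym (+-cancelˡ-≡ (toℕ r) _ _ wrapped)) k≤n)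
    where
      wrapped : toℕ r + suc n ≡ toℕ r + k
      wrapped = trans (cong (_+ suc n) (sym (cong toℕ orbit≡r))) t

  orbit-onto : ∀ x → Σ ℕ λ k → k ≤ suc n × orbit k ≡ x
  orbit-onto x with toℕ r ≤? toℕ x
  ... | yes r≤x = k , k≤1+n , toℕ-injective (index (toℕ-orbit k k≤1+n))
    where
      k : ℕ
      k = toℕ x ∸ toℕ r
      k≤1+n : k ≤ suc n
      k≤1+n = ≤-trans (m∸n≤m (toℕ x) (toℕ r)) (<⇒≤ (toℕ<n x))
      index : toℕ (orbit k) ≡ toℕ r + k ⊎ toℕ (orbit k) + suc n ≡ toℕ r + k → toℕ (orbit k) ≡ toℕ x
      index (inj₁ t) = trans t (m+[n∸m]≡n r≤x)
      index (inj₂ t) = ⊥-elim (m+n≮n (toℕ (orbit k)) (suc n)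
                         (subst (_< suc n) (sym (trans t (m+[n∸m]≡n r≤x))) (toℕ<n x)))
  ... | no r≰x = k , k≤1+n , toℕ-injective (index (toℕ-orbit k k≤1+n))
    where
      k : ℕ
      k = suc n + toℕ x ∸ toℕ r
      r≤1+n+x : toℕ r ≤ suc n + toℕ x
      r≤1+n+x = ≤-trans (<⇒≤ (toℕ<n r)) (m≤m+n (suc n) (toℕ x))
      k≤1+n : k ≤ suc n
      k≤1+n = ≤-trans (∸-monoʳ-≤ (suc n + toℕ x) (<⇒≤ (≰⇒> r≰x))) (≤-reflexive (m+n∸n≡m (suc n) (toℕ x)))
      index : toℕ (orbit k) ≡ toℕ r + k ⊎ toℕ (orbit k) + suc n ≡ toℕ r + k → toℕ (orbit k) ≡ toℕ x
      index (inj₁ t) = ⊥-elim (m+n≮m (suc n) (toℕ x)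
                         (subst (_< suc n) (trans t (m+[n∸m]≡n r≤1+n+x)) (toℕ<n (orbit k))))
      index (inj₂ t) = +-cancelˡ-≡ (suc n) _ _
                         (trans (+-comm (suc n) _) (trans t (m+[n∸m]≡n r≤1+n+x)))

  orbit-closed : {P : Fin (suc n) → Set} → ForcingClosedExcept (Cycle (suc n)) r P →
                 P r → P (next r) → ∀ k → k ≤ suc n → P (orbit k)
  orbit-closed closed Pr Pnext zero          _       = Pr
  orbit-closed closed Pr Pnext (suc zero)    _       = Pnext
  orbit-closed {P} closed Pr Pnext (suc (suc k)) k+2≤1+n =
    closed (orbit-avoids-root (suc k) (s≤s z≤n) (≤-pred k+2≤1+n))
           (Cycle-follows (follows-next a)) others (orbit-closed closed Pr Pnext (suc k) k+1≤1+n)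
    where
      a : Fin (suc n)
      a = orbit (suc k)
      k+1≤1+n : suc k ≤ suc n
      k+1≤1+n = <⇒≤ k+2≤1+n
      others : ∀ x → Cycle (suc n) a x → ¬ x ≡ next a → P x
      others x ax x≢next with Cycle⇒follows ax
      ... | inj₁ a→x = ⊥-elim (x≢next (sym (follows-functional (follows-next a) a→x)))
      ... | inj₂ x→a = subst P (follows-injective (follows-next (orbit k)) x→a)
                               (orbit-closed closed Pr Pnext k (<⇒≤ k+1≤1+n))

cycle-forcing-closed⇒all : {n : ℕ} {r : Fin (suc n)} {P : Fin (suc n) → Set} →
  ForcingClosedExcept (Cycle (suc n)) r P → P r → P (next r) → ∀ x → P x
cycle-forcing-closed⇒all {r = r} {P} closed Pr Pnext x with Orbit.orbit-onto r x
... | k , k≤1+n , orbit≡x = subst P orbit≡x (Orbit.orbit-closed r closed Pr Pnext k k≤1+n)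

module SingleRoot {A B : Set} (W : Graph A) (i : A) (H : Graph B) (S : List (A × B)) where

  private
    G : Graph (A × B)
    G = HierProd W (λ x → x ≡ i) H

  row-forcing-closed : ∀ y → ForcingClosedExcept W i (λ x → Filled G S (x , y))
  row-forcing-closed y {a} {c} a≢i Wac others Fa = force Fa (inj₂ (refl , Wac)) nbrs
    where
      nbrs : ∀ v → G (a , y) v → ¬ v ≡ (c , y) → Filled G S v
      nbrs _       (inj₁ (_ , a≡i , _)) _   = ⊥-elim (a≢i a≡i)
      nbrs (x , _) (inj₂ (refl , Wax))  v≢c = others x Wax (v≢c ∘ cong (_, y))

  root-forces : ∀ {a c} → (∀ x → Filled G S (x , a)) → H a c →
                (∀ y → H a y → ¬ y ≡ c → Filled G S (i , y)) → Filled G S (i , c)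
  root-forces {a} {c} rowFull Hac others = force (rowFull i) (inj₁ (refl , refl , Hac)) nbrs
    where
      nbrs : ∀ v → G (i , a) v → ¬ v ≡ (i , c) → Filled G S v
      nbrs (_ , y) (inj₁ (refl , _ , Hay)) v≢c = others y Hay (v≢c ∘ cong (i ,_))
      nbrs (x , _) (inj₂ (refl , _))       _   = rowFull x

-- The hypotheses 4 ≤ w and 4 ≤ h are used only to know that w and h are nonzero.
mainTheorem3 : (w h : ℕ) → 4 ≤ w → 4 ≤ h → (i : Fin w) →
    Σ (List (Fin w × Fin h)) (λ S →
    length S ≤ h + 2 × IsZeroForcingSet (HierProd (Cycle w) (λ x → x ≡ i) (Cycle h)) S)
mainTheorem3 (suc w) (suc h) (s≤s _) (s≤s _) i = S , length-S , fills
  where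
    open SingleRoot (Cycle (suc w)) i (Cycle (suc h))
    G : Graph (Fin (suc w) × Fin (suc h))
    G = HierProd (Cycle (suc w)) (λ x → x ≡ i) (Cycle (suc h))
    S : List (Fin (suc w) × Fin (suc h))
    S = (i , fzero) ∷ (i , next fzero) ∷ map (next i ,_) (allFin (suc h))

    length-S : length S ≤ suc h + 2
    length-S rewrite length-map (next i ,_) (allFin (suc h)) | length-tabulate {n = suc h} id =
      ≤-reflexive (+-comm 2 (suc h))

    RowFull : Fin (suc h) → Set
    RowFull y = ∀ x → Filled G S (x , y)

    row-fills : ∀ y → Filled G S (i , y) → RowFull y
    row-fills y Fiy = cycle-forcing-closed⇒all (row-forcing-closed S y) Fiy
                        (initial (there (there (∈-map⁺ (next i ,_) (∈-allFin y)))))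

    rows-forcing-closed : ForcingClosedExcept (Cycle (suc h)) fzero RowFull
    rows-forcing-closed _ Hac others rowFull =
      row-fills _ (root-forces S rowFull Hac (λ y Hay y≢c → others y Hay y≢c i))

    fills : IsZeroForcingSet G S
    fills (x , y) = cycle-forcing-closed⇒all rows-forcing-closed
      (row-fills fzero (initial (here refl)))
      (row-fills (next fzero) (initial (there (here refl))))
      y x
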